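{- Let $r\geq 3$ and let $n_{1},n_{2},\ldots,n_{r}$ be positive integers with $n_{1}\leq n_{2}\leq \cdots \leq n_{r}$ such that $\sum_{i=1}^{r}n_{i}$ is odd. Then $$\mathrm{def}\left(K_{n_{1},n_{2},\ldots,n_{r}}\right)\geq \sum_{i=2}^{r}\frac{(n_{1}+1)n_{i}-n_{i}^{2}}{2}.$$
   Context: All graphs are finite, simple, undirected. $K_{n_1,\ldots,n_r}$ denotes the complete $r$-partite graph whose vertex set is partitioned into independent sets of sizes $n_1,\ldots,n_r$, with every two vertices in different parts adjacent. For a proper edge-coloring $\alpha$ of a graph $G$ (with positive integer colors) and a vertex $v$, let $S(v,\alpha)$ be the set of colors on edges incident to $v$, and $\mathrm{def}(v,\alpha)=\max S(v,\alpha)-\min S(v,\alpha)-|S(v,\alpha)|+1$ (the number of integers missing from $S(v,\alpha)$ to form an interval; $0$ if $v$ is isolated). The deficiency of $\alpha$ is $\mathrm{def}(G,\alpha)=\sum_{v\in V(G)}\mathrm{def}(v,\alpha)$, and the deficiency of $G$ is $\mathrm{def}(G)=\min_\alpha \mathrm{def}(G,\alpha)$ over all proper edge-colorings $\alpha$ of $G$. Equivalently, $\mathrm{def}(G)$ is the minimum number of pendant edges whose attachment to $G$ yields a graph admitting an interval coloring (a proper edge-coloring with colors $1,\ldots,t$, all used, in which every vertex's color set is an integer interval). -}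

module Defs where

open import Data.Nat using (ℕ; zero; suc; _+_; _∸_; _⊔_; _⊓_; _≤_)
import Data.Nat
open import Data.Fin as Fin using (Fin; zero; suc)
open import Data.List using (List; []; _∷_; map; concatMap; filter; length; foldr; deduplicate)
open import Data.Nat.ListAction using (sum)
open import Data.List using () renaming (allFin to allFinL)
open import Data.Product using (Σ; _,_; proj₁; proj₂)
open import Data.Integer as ℤ using (ℤ)
open import Relation.Nullary using (¬_; ¬?)
open import Relation.Binary.PropositionalEquality using (_≡_; _≢_)

-- The complete multipartite graph K_{n_0,...,n_{r-1}}: part sizes given by n : Fin r → ℕ.
-- A vertex is a pair (part index i, index j within part i).
Vertex : {r : ℕ} → (Fin r → ℕ) → Set
Vertex {r} n = Σ (Fin r) (λ i → Fin (n i))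

Adj : {r : ℕ} (n : Fin r → ℕ) → Vertex n → Vertex n → Set
Adj n u v = proj₁ u ≢ proj₁ v

vertices : {r : ℕ} (n : Fin r → ℕ) → List (Vertex n)
vertices {r} n = concatMap (λ i → map (λ j → (i , j)) (allFinL (n i))) (allFinL r)

neighbours : {r : ℕ} (n : Fin r → ℕ) → Vertex n → List (Vertex n)
neighbours n v = filter (λ w → ¬? (proj₁ v Fin.≟ proj₁ w)) (vertices n)

-- A proper edge-coloring of K_n with positive integer colors, given as a symmetric
-- function on vertex pairs (only its values on adjacent pairs, i.e. edges, matter).
record ProperEdgeColoring {r : ℕ} (n : Fin r → ℕ) : Set where
  field
    col      : Vertex n → Vertex n → ℕ
    symm     : ∀ u v → Adj n u v → col u v ≡ col v u
    positive : ∀ u v → Adj n u v → 1 ≤ col u v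
    proper   : ∀ u v w → Adj n u v → Adj n u w → v ≢ w → col u v ≢ col u w
open ProperEdgeColoring public

maxL : ℕ → List ℕ → ℕ
maxL x xs = foldr _⊔_ x xs

minL : ℕ → List ℕ → ℕ
minL x xs = foldr _⊓_ x xs

-- S(v,α) as a list (possibly with repetitions) of the colors at v
colorsAt : {r : ℕ} {n : Fin r → ℕ} → ProperEdgeColoring n → Vertex n → List ℕ
colorsAt {n = n} α v = map (col α v) (neighbours n v)

defList : List ℕ → ℕ
defList []       = 0
defList (x ∷ xs) = suc (maxL x xs) ∸ minL x xs ∸ length (deduplicate Data.Nat._≟_ (x ∷ xs))

defVertex : {r : ℕ} {n : Fin r → ℕ} → ProperEdgeColoring n → Vertex n → ℕ
defVertex α v = defList (colorsAt α v)

defColoring : {r : ℕ} {n : Fin r → ℕ} → ProperEdgeColoring n → ℕ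
defColoring {n = n} α = sum (map (defVertex α) (vertices n))

sumℤ : {k : ℕ} → (Fin k → ℤ) → ℤ
sumℤ {k} f = foldr ℤ._+_ (ℤ.+ 0) (map f (allFinL k))

total : {r : ℕ} → (Fin r → ℕ) → ℕ
total {r} n = sum (map n (allFinL r))

-- Let α be a proper colouring of K_{n₁,…,n_r} with N = n₁ + ⋯ + n_r odd, and put D = N − n₁, so that
-- every degree is at most D.  Write [lo v, hi v] for the hull of the colours at v; its excess over
-- deg v, the gap at v, is a lower bound for def(v, α).
-- Parity: colour c occurs at an even number of vertices (every edge has two ends), so whenever an odd
-- number of hulls contain c, one of them misses c; hence the number of such "odd" colours is at most
-- the total gap.
-- Residues mod D: a hull of length ℓ meets each residue class mod D exactly once if ℓ = D; in general
-- its total deviation from "once" over the D classes is |ℓ − D| ≤ (ℓ − deg v) + (D − deg v).  If no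
-- hull deviates at ρ, the colours ≡ ρ are covered N times in total, which is odd, so one of them is an
-- odd colour.  Therefore D ≤ 2 def(α) + Σ_v (D − deg v) = 2 def(α) + Σ_{i≥2} nᵢ (nᵢ − n₁), which
-- rearranges to the claim.

module Submission where

open import Defs
open import Data.Nat as ℕ
open import Data.Nat.Properties
open import Data.Nat.DivMod using (%-distribˡ-+; m%n≤m; [m+kn]%n≡m%n)
open import Data.Nat.Tactic.RingSolver using (solve-∀)
import Algebra.Properties.CommutativeSemigroup +-commutativeSemigroup as +-CS
open import Data.Fin as Fin using (Fin; zero; suc)
import Data.Fin.Properties as Fin
open import Data.List using (List; []; _∷_; map; concatMap; filter; length; tabulate; _++_; foldr)
open import Data.List using () renaming (allFin to allFinL)
import Data.List.Properties as List
open import Data.List.Membership.Propositional using (_∈_)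
open import Data.List.Membership.Propositional.Properties using (∈-map⁺; ∈-filter⁺; ∈-concatMap⁺; ∈-allFin)
open import Data.List.Relation.Unary.Any as Any using (here; there)
open import Data.Nat.ListAction using (sum)
open import Data.Nat.ListAction.Properties using (sum-++)
open import Data.Product using (∃; _,_; proj₁; _×_)
import Data.Product.Properties as Product
open import Data.Empty using (⊥-elim)
open import Relation.Nullary using (Dec; yes; no; ¬_; ¬?)
open import Relation.Binary.PropositionalEquality

private
  variable
    A B P P′ : Set

-- Indicators and finite sums

χ : Dec P → ℕ
χ (yes _) = 1
χ (no _)  = 0

χ-yes : (d : Dec P) → P → χ d ≡ 1
χ-yes (yes _) _  = refl
χ-yes (no ¬p) p = ⊥-elim (¬p p)

χ-no : (d : Dec P) → ¬ P → χ d ≡ 0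
χ-no (yes p) ¬p = ⊥-elim (¬p p)
χ-no (no _)  _  = refl

χ≤1 : (d : Dec P) → χ d ≤ 1
χ≤1 (yes _) = s≤s z≤n
χ≤1 (no _)  = z≤n

χ-mono : (d : Dec P) (e : Dec P′) → (P → P′) → χ d ≤ χ e
χ-mono (yes p) (yes _) _ = ≤-refl
χ-mono (yes p) (no ¬q) f = ⊥-elim (¬q (f p))
χ-mono (no _)  _       _ = z≤n

χ-cong : (d : Dec P) (e : Dec P′) → (P → P′) → (P′ → P) → χ d ≡ χ e
χ-cong d e f g = ≤-antisym (χ-mono d e f) (χ-mono e d g)

∑ : List A → (A → ℕ) → ℕ
∑ xs f = sum (map f xs)

∑-cong : (xs : List A) {f g : A → ℕ} → (∀ x → f x ≡ g x) → ∑ xs f ≡ ∑ xs g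
∑-cong []       e = refl
∑-cong (x ∷ xs) e = cong₂ _+_ (e x) (∑-cong xs e)

∑-mono : (xs : List A) {f g : A → ℕ} → (∀ x → f x ≤ g x) → ∑ xs f ≤ ∑ xs g
∑-mono []       e = z≤n
∑-mono (x ∷ xs) e = +-mono-≤ (e x) (∑-mono xs e)

∑-zero : (xs : List A) → ∑ xs (λ _ → 0) ≡ 0
∑-zero []       = refl
∑-zero (x ∷ xs) = ∑-zero xs

∑-+ : (xs : List A) (f g : A → ℕ) → ∑ xs (λ x → f x + g x) ≡ ∑ xs f + ∑ xs g
∑-+ []       f g = refl
∑-+ (x ∷ xs) f g = begin
  f x + g x + ∑ xs (λ x → f x + g x)  ≡⟨ cong (f x + g x +_) (∑-+ xs f g) ⟩
  f x + g x + (∑ xs f + ∑ xs g)       ≡⟨ +-CS.interchange (f x) (g x) (∑ xs f) (∑ xs g) ⟩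
  f x + ∑ xs f + (g x + ∑ xs g)       ∎
  where open ≡-Reasoning

∑-∸ : (xs : List A) {f g : A → ℕ} → (∀ x → g x ≤ f x) → ∑ xs (λ x → f x ∸ g x) ≡ ∑ xs f ∸ ∑ xs g
∑-∸ xs {f} {g} g≤f = begin
  ∑ xs (λ x → f x ∸ g x)                     ≡⟨ m+n∸n≡m _ (∑ xs g) ⟨
  ∑ xs (λ x → f x ∸ g x) + ∑ xs g ∸ ∑ xs g   ≡⟨ cong (_∸ ∑ xs g) (∑-+ xs (λ x → f x ∸ g x) g) ⟨
  ∑ xs (λ x → f x ∸ g x + g x) ∸ ∑ xs g      ≡⟨ cong (_∸ ∑ xs g) (∑-cong xs (λ x → m∸n+n≡m (g≤f x))) ⟩
  ∑ xs f ∸ ∑ xs g                            ∎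
  where open ≡-Reasoning

∑-≥ : (xs : List A) (f : A → ℕ) {x : A} → x ∈ xs → f x ≤ ∑ xs f
∑-≥ (y ∷ xs) f (here refl) = m≤m+n (f y) _
∑-≥ (y ∷ xs) f (there x∈)  = ≤-trans (∑-≥ xs f x∈) (m≤n+m _ (f y))

∑-++ : (xs ys : List A) (g : A → ℕ) → ∑ (xs ++ ys) g ≡ ∑ xs g + ∑ ys g
∑-++ xs ys g = trans (cong sum (List.map-++ g xs ys)) (sum-++ (map g xs) (map g ys))

∑-map : (h : A → B) (xs : List A) (g : B → ℕ) → ∑ (map h xs) g ≡ ∑ xs (λ x → g (h x))
∑-map h xs g = cong sum (sym (List.map-∘ xs))

∑-concatMap : (f : A → List B) (xs : List A) (g : B → ℕ) →
              ∑ (concatMap f xs) g ≡ ∑ xs (λ x → ∑ (f x) g)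
∑-concatMap f []       g = refl
∑-concatMap f (x ∷ xs) g =
  trans (∑-++ (f x) (concatMap f xs) g) (cong (∑ (f x) g +_) (∑-concatMap f xs g))

length-filter : {P : A → Set} (P? : ∀ x → Dec (P x)) (xs : List A) →
                length (filter P? xs) ≡ ∑ xs (λ x → χ (P? x))
length-filter P? []       = refl
length-filter P? (x ∷ xs) with P? x
... | yes _ = cong suc (length-filter P? xs)
... | no _  = length-filter P? xs

∑∑-symmetric-double : (xs : List A) (f : A → A → ℕ) → (∀ x y → f x y ≡ f y x) → (∀ x → f x x ≡ 0) →
                      ∃ λ m → ∑ xs (λ x → ∑ xs (f x)) ≡ m + m
∑∑-symmetric-double []       f sym-f diag-f = 0 , refl
∑∑-symmetric-double (a ∷ xs) f sym-f diag-f with ∑∑-symmetric-double xs f sym-f diag-f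
... | m , eq = t + m , (begin
  f a a + t + ∑ xs (λ x → f x a + ∑ xs (f x))
    ≡⟨ cong₂ (λ u w → u + t + w) (diag-f a) (∑-+ xs (λ x → f x a) (λ x → ∑ xs (f x))) ⟩
  t + (∑ xs (λ x → f x a) + ∑ xs (λ x → ∑ xs (f x)))
    ≡⟨ cong₂ (λ u w → t + (u + w)) (∑-cong xs (λ x → sym-f x a)) eq ⟩
  t + (t + (m + m))
    ≡⟨ regroup t m ⟩
  t + m + (t + m)
    ∎)
  where
  open ≡-Reasoning
  t = ∑ xs (f a)
  regroup : ∀ t m → t + (t + (m + m)) ≡ t + m + (t + m)
  regroup = solve-∀

∑∣f-1∣≡0⇒∑f≡∑1 : (xs : List A) (f : A → ℕ) → ∑ xs (λ x → ∣ f x - 1 ∣) ≡ 0 → ∑ xs f ≡ ∑ xs (λ _ → 1)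
∑∣f-1∣≡0⇒∑f≡∑1 []       f eq = refl
∑∣f-1∣≡0⇒∑f≡∑1 (x ∷ xs) f eq =
  cong₂ _+_ (∣m-n∣≡0⇒m≡n (m+n≡0⇒m≡0 _ eq)) (∑∣f-1∣≡0⇒∑f≡∑1 xs f (m+n≡0⇒n≡0 _ eq))

%2-+ : ∀ a b → (a + b) % 2 ≤ a % 2 + b % 2
%2-+ a b = ≤-trans (≤-reflexive (%-distribˡ-+ a b 2)) (m%n≤m (a % 2 + b % 2) 2)

%2≤∸-double : ∀ s m → m + m ≤ s → s % 2 ≤ s ∸ (m + m)
%2≤∸-double s m 2m≤s = begin
  s % 2                          ≡⟨ cong (_% 2) (m∸n+n≡m 2m≤s) ⟨
  (s ∸ (m + m) + (m + m)) % 2    ≡⟨ cong (λ t → (s ∸ (m + m) + t) % 2) (double≡*2 m) ⟩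
  (s ∸ (m + m) + m * 2) % 2      ≡⟨ [m+kn]%n≡m%n (s ∸ (m + m)) m 2 ⟩
  (s ∸ (m + m)) % 2              ≤⟨ m%n≤m (s ∸ (m + m)) 2 ⟩
  s ∸ (m + m)                    ∎
  where
  open ≤-Reasoning
  double≡*2 : ∀ m → m + m ≡ m * 2
  double≡*2 = solve-∀

∑1-odd⇒1≤∑f%2+∑∣f-1∣ : (xs : List A) (f : A → ℕ) → ∑ xs (λ _ → 1) % 2 ≡ 1 →
                       1 ≤ ∑ xs f % 2 + ∑ xs (λ x → ∣ f x - 1 ∣)
∑1-odd⇒1≤∑f%2+∑∣f-1∣ xs f odd with ∑ xs (λ x → ∣ f x - 1 ∣) in eq
... | suc d = ≤-trans (s≤s z≤n) (m≤n+m (suc d) _)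
... | zero  = ≤-trans (≤-reflexive (sym odd))
                (≤-trans (≤-reflexive (cong (_% 2) (sym (∑∣f-1∣≡0⇒∑f≡∑1 xs f eq)))) (m≤m+n _ 0))

∑< : ℕ → (ℕ → ℕ) → ℕ
∑< zero    g = 0
∑< (suc m) g = ∑< m g + g m

∑<-cong : (m : ℕ) {f g : ℕ → ℕ} → (∀ c → c < m → f c ≡ g c) → ∑< m f ≡ ∑< m g
∑<-cong zero    e = refl
∑<-cong (suc m) e = cong₂ _+_ (∑<-cong m (λ c c<m → e c (m<n⇒m<1+n c<m))) (e m (n<1+n m))

∑<-mono : (m : ℕ) {f g : ℕ → ℕ} → (∀ c → f c ≤ g c) → ∑< m f ≤ ∑< m g
∑<-mono zero    e = z≤n
∑<-mono (suc m) e = +-mono-≤ (∑<-mono m e) (e m)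

∑<-zero : (m : ℕ) → ∑< m (λ _ → 0) ≡ 0
∑<-zero zero    = refl
∑<-zero (suc m) = cong (_+ 0) (∑<-zero m)

∑<-one : (m : ℕ) → ∑< m (λ _ → 1) ≡ m
∑<-one zero    = refl
∑<-one (suc m) = trans (cong (_+ 1) (∑<-one m)) (+-comm m 1)

∑<-+ : (m : ℕ) (f g : ℕ → ℕ) → ∑< m (λ c → f c + g c) ≡ ∑< m f + ∑< m g
∑<-+ zero    f g = refl
∑<-+ (suc m) f g =
  trans (cong (_+ (f m + g m)) (∑<-+ m f g)) (+-CS.interchange (∑< m f) (∑< m g) (f m) (g m))

∑<-∸ : (m : ℕ) {f g : ℕ → ℕ} → (∀ c → g c ≤ f c) → ∑< m (λ c → f c ∸ g c) ≡ ∑< m f ∸ ∑< m g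
∑<-∸ m {f} {g} g≤f = begin
  ∑< m (λ c → f c ∸ g c)                     ≡⟨ m+n∸n≡m _ (∑< m g) ⟨
  ∑< m (λ c → f c ∸ g c) + ∑< m g ∸ ∑< m g   ≡⟨ cong (_∸ ∑< m g) (∑<-+ m (λ c → f c ∸ g c) g) ⟨
  ∑< m (λ c → f c ∸ g c + g c) ∸ ∑< m g      ≡⟨ cong (_∸ ∑< m g) (∑<-cong m (λ c _ → m∸n+n≡m (g≤f c))) ⟩
  ∑< m f ∸ ∑< m g                            ∎
  where open ≡-Reasoning

∑<-*ˡ : (m a : ℕ) (g : ℕ → ℕ) → ∑< m (λ c → a * g c) ≡ a * ∑< m g
∑<-*ˡ zero    a g = sym (*-zeroʳ a)
∑<-*ˡ (suc m) a g = trans (cong (_+ a * g m) (∑<-*ˡ m a g)) (sym (*-distribˡ-+ a (∑< m g) (g m)))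

∑<-∑ : (m : ℕ) (xs : List A) (f : A → ℕ → ℕ) → ∑< m (λ c → ∑ xs (λ x → f x c)) ≡ ∑ xs (λ x → ∑< m (f x))
∑<-∑ zero    xs f = sym (∑-zero xs)
∑<-∑ (suc m) xs f =
  trans (cong (_+ ∑ xs (λ x → f x m)) (∑<-∑ m xs f)) (sym (∑-+ xs (λ x → ∑< m (f x)) (λ x → f x m)))

∑<-split : (a b : ℕ) (g : ℕ → ℕ) → ∑< (a + b) g ≡ ∑< a g + ∑< b (λ c → g (a + c))
∑<-split a zero    g = trans (cong (λ t → ∑< t g) (+-identityʳ a)) (sym (+-identityʳ (∑< a g)))
∑<-split a (suc b) g = begin
  ∑< (a + suc b) g                                 ≡⟨ cong (λ t → ∑< t g) (+-suc a b) ⟩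
  ∑< (a + b) g + g (a + b)                         ≡⟨ cong (_+ g (a + b)) (∑<-split a b g) ⟩
  ∑< a g + ∑< b (λ c → g (a + c)) + g (a + b)      ≡⟨ +-assoc (∑< a g) _ _ ⟩
  ∑< a g + ∑< (suc b) (λ c → g (a + c))            ∎
  where open ≡-Reasoning

∑<-blocks : (Q D : ℕ) (g : ℕ → ℕ) → ∑< (Q * D) g ≡ ∑< D (λ ρ → ∑< Q (λ q → g (q * D + ρ)))
∑<-blocks zero    D g = sym (∑<-zero D)
∑<-blocks (suc Q) D g = begin
  ∑< (D + Q * D) g
    ≡⟨ cong (λ t → ∑< t g) (+-comm D (Q * D)) ⟩
  ∑< (Q * D + D) g
    ≡⟨ ∑<-split (Q * D) D g ⟩
  ∑< (Q * D) g + ∑< D (λ ρ → g (Q * D + ρ))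
    ≡⟨ cong (_+ ∑< D (λ ρ → g (Q * D + ρ))) (∑<-blocks Q D g) ⟩
  ∑< D (λ ρ → ∑< Q (λ q → g (q * D + ρ))) + ∑< D (λ ρ → g (Q * D + ρ))
    ≡⟨ ∑<-+ D (λ ρ → ∑< Q (λ q → g (q * D + ρ))) (λ ρ → g (Q * D + ρ)) ⟨
  ∑< D (λ ρ → ∑< (suc Q) (λ q → g (q * D + ρ)))
    ∎
  where open ≡-Reasoning

∑<-%2 : (m : ℕ) (g : ℕ → ℕ) → ∑< m g % 2 ≤ ∑< m (λ c → g c % 2)
∑<-%2 zero    g = z≤n
∑<-%2 (suc m) g = ≤-trans (%2-+ (∑< m g) (g m)) (+-monoˡ-≤ (g m % 2) (∑<-%2 m g))

∑<-χ< : (m x : ℕ) → x ≤ m → ∑< m (λ c → χ (c <? x)) ≡ x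
∑<-χ< m x x≤m = trans (count m) (m≥n⇒m⊓n≡n x≤m)
  where
  count : ∀ m → ∑< m (λ c → χ (c <? x)) ≡ m ⊓ x
  count zero = refl
  count (suc m) with m <? x
  ... | yes m<x = trans (cong (_+ 1) (trans (count m) (m≤n⇒m⊓n≡m (<⇒≤ m<x))))
                        (trans (+-comm m 1) (sym (m≤n⇒m⊓n≡m m<x)))
  ... | no m≮x  = trans (cong (_+ 0) (trans (count m) (m≥n⇒m⊓n≡n (≮⇒≥ m≮x))))
                        (trans (+-identityʳ x) (sym (m≥n⇒m⊓n≡n (m≤n⇒m≤1+n (≮⇒≥ m≮x)))))

inRange : ℕ → ℕ → ℕ → ℕ
inRange a b c = χ (c <? b) ∸ χ (c <? a)

∑<-inRange : (m : ℕ) {a b : ℕ} → a ≤ b → b ≤ m → ∑< m (inRange a b) ≡ b ∸ a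
∑<-inRange m {a} {b} a≤b b≤m = begin
  ∑< m (inRange a b)                                   ≡⟨ ∑<-∸ m (λ c → χ-mono (c <? a) (c <? b) (λ c<a → <-≤-trans c<a a≤b)) ⟩
  ∑< m (λ c → χ (c <? b)) ∸ ∑< m (λ c → χ (c <? a))    ≡⟨ cong₂ _∸_ (∑<-χ< m b b≤m) (∑<-χ< m a (≤-trans a≤b b≤m)) ⟩
  b ∸ a                                                ∎
  where open ≡-Reasoning

χ≟-inRange : (y c : ℕ) → χ (y ≟ c) ≡ inRange y (suc y) c
χ≟-inRange y c with y ≟ c
... | yes refl = sym (cong₂ _∸_ (χ-yes (y <? suc y) ≤-refl) (χ-no (y <? y) (n≮n y)))
... | no y≢c   = sym (trans (cong (_∸ χ (c <? y)) same) (n∸n≡0 (χ (c <? y))))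
  where
  same : χ (c <? suc y) ≡ χ (c <? y)
  same = χ-cong (c <? suc y) (c <? y) (λ c<1+y → ≤∧≢⇒< (s≤s⁻¹ c<1+y) (λ c≡y → y≢c (sym c≡y))) m<n⇒m<1+n

∑ᶠ : (m : ℕ) → (Fin m → ℕ) → ℕ
∑ᶠ zero    g = 0
∑ᶠ (suc m) g = g zero + ∑ᶠ m (λ i → g (suc i))

∑-tabulate : (m : ℕ) (f : Fin m → A) (g : A → ℕ) → ∑ (tabulate f) g ≡ ∑ᶠ m (λ i → g (f i))
∑-tabulate zero    f g = refl
∑-tabulate (suc m) f g = cong (g (f zero) +_) (∑-tabulate m (λ i → f (suc i)) g)

∑-allFin : (m : ℕ) (g : Fin m → ℕ) → ∑ (allFinL m) g ≡ ∑ᶠ m g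
∑-allFin m g = ∑-tabulate m (λ i → i) g

∑ᶠ-cong : (m : ℕ) {f g : Fin m → ℕ} → (∀ i → f i ≡ g i) → ∑ᶠ m f ≡ ∑ᶠ m g
∑ᶠ-cong zero    e = refl
∑ᶠ-cong (suc m) e = cong₂ _+_ (e zero) (∑ᶠ-cong m (λ i → e (suc i)))

∑ᶠ-const : (m c : ℕ) → ∑ᶠ m (λ _ → c) ≡ m * c
∑ᶠ-const zero    c = refl
∑ᶠ-const (suc m) c = cong (c +_) (∑ᶠ-const m c)

∑ᶠ-≥ : (m : ℕ) (f : Fin m → ℕ) (i : Fin m) → f i ≤ ∑ᶠ m f
∑ᶠ-≥ (suc m) f zero    = m≤m+n (f zero) _
∑ᶠ-≥ (suc m) f (suc i) = ≤-trans (∑ᶠ-≥ m (λ i → f (suc i)) i) (m≤n+m _ (f zero))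

∑ᶠ-positive : (m : ℕ) (f : Fin m → ℕ) → 1 ≤ ∑ᶠ m f → ∃ λ i → 1 ≤ f i
∑ᶠ-positive (suc m) f 1≤∑ with f zero in eq
... | suc _ = zero , subst (1 ≤_) (sym eq) (s≤s z≤n)
... | zero with ∑ᶠ-positive m (λ i → f (suc i)) 1≤∑
...   | i , 1≤fi = suc i , 1≤fi

∑ᶠ-≤1 : (m : ℕ) (f : Fin m → ℕ) → (∀ i → f i ≤ 1) → (∀ i i' → 1 ≤ f i → 1 ≤ f i' → i ≡ i') → ∑ᶠ m f ≤ 1
∑ᶠ-≤1 zero    f f≤1 unique = z≤n
∑ᶠ-≤1 (suc m) f f≤1 unique with f zero in eq
... | zero          = ∑ᶠ-≤1 m (λ i → f (suc i)) (λ i → f≤1 (suc i))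
                        (λ i i' p q → Fin.suc-injective (unique (suc i) (suc i') p q))
... | suc zero with ∑ᶠ m (λ i → f (suc i)) in eq'
...   | zero  = ≤-refl
...   | suc _ with ∑ᶠ-positive m (λ i → f (suc i)) (subst (1 ≤_) (sym eq') (s≤s z≤n))
...     | i , 1≤fi with unique zero (suc i) (subst (1 ≤_) (sym eq) ≤-refl) 1≤fi
...       | ()
∑ᶠ-≤1 (suc m) f f≤1 unique | suc (suc _) with subst (_≤ 1) eq (f≤1 zero)
...   | s≤s ()

∑ᶠ-except : (m : ℕ) (g : Fin m → ℕ) (i : Fin m) → ∑ᶠ m (λ i' → g i' * χ (¬? (i Fin.≟ i'))) + g i ≡ ∑ᶠ m g
∑ᶠ-except (suc m) g zero = begin
  g zero * χ (¬? (zero {m} Fin.≟ zero)) + ∑ᶠ m (λ i' → g (suc i') * χ (¬? (zero Fin.≟ suc i'))) + g zero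
    ≡⟨ cong₂ (λ a b → g zero * a + b + g zero) (χ-no (¬? (zero {m} Fin.≟ zero)) (λ ≢ → ≢ refl))
             (∑ᶠ-cong m (λ i' → cong (g (suc i') *_) (χ-yes (¬? (zero Fin.≟ suc i')) λ ()))) ⟩
  g zero * 0 + ∑ᶠ m (λ i' → g (suc i') * 1) + g zero
    ≡⟨ cong₂ (λ a b → a + b + g zero) (*-zeroʳ (g zero)) (∑ᶠ-cong m (λ i' → *-identityʳ (g (suc i')))) ⟩
  ∑ᶠ m (λ i' → g (suc i')) + g zero
    ≡⟨ +-comm _ (g zero) ⟩
  g zero + ∑ᶠ m (λ i' → g (suc i'))
    ∎
  where open ≡-Reasoning
∑ᶠ-except (suc m) g (suc i) = begin
  g zero * χ (¬? (suc i Fin.≟ zero)) + ∑ᶠ m (λ i' → g (suc i') * χ (¬? (suc i Fin.≟ suc i'))) + g (suc i)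
    ≡⟨ cong₂ (λ a b → g zero * a + b + g (suc i)) (χ-yes (¬? (suc i Fin.≟ zero)) λ ())
             (∑ᶠ-cong m (λ i' → cong (g (suc i') *_)
               (χ-cong (¬? (suc i Fin.≟ suc i')) (¬? (i Fin.≟ i')) (λ ≢ ≡ → ≢ (cong suc ≡)) (λ ≢ ≡ → ≢ (Fin.suc-injective ≡))))) ⟩
  g zero * 1 + ∑ᶠ m (λ i' → g (suc i') * χ (¬? (i Fin.≟ i'))) + g (suc i)
    ≡⟨ +-assoc (g zero * 1) _ _ ⟩
  g zero * 1 + (∑ᶠ m (λ i' → g (suc i') * χ (¬? (i Fin.≟ i'))) + g (suc i))
    ≡⟨ cong₂ _+_ (*-identityʳ (g zero)) (∑ᶠ-except m (λ i' → g (suc i')) i) ⟩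
  g zero + ∑ᶠ m (λ i' → g (suc i'))
    ∎
  where open ≡-Reasoning

minL-≤ : ∀ x xs {y} → y ∈ x ∷ xs → minL x xs ≤ y
minL-≤ x []       (here refl)         = ≤-refl
minL-≤ x (z ∷ zs) (here refl)         = ≤-trans (m⊓n≤n z (minL x zs)) (minL-≤ x zs (here refl))
minL-≤ x (z ∷ zs) (there (here refl)) = m⊓n≤m z (minL x zs)
minL-≤ x (z ∷ zs) (there (there y∈))  = ≤-trans (m⊓n≤n z (minL x zs)) (minL-≤ x zs (there y∈))

≤-maxL : ∀ x xs {y} → y ∈ x ∷ xs → y ≤ maxL x xs
≤-maxL x []       (here refl)         = ≤-refl
≤-maxL x (z ∷ zs) (here refl)         = ≤-trans (≤-maxL x zs (here refl)) (m≤n⊔m z (maxL x zs))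
≤-maxL x (z ∷ zs) (there (here refl)) = m≤m⊔n z (maxL x zs)
≤-maxL x (z ∷ zs) (there (there y∈))  = ≤-trans (≤-maxL x zs (there y∈)) (m≤n⊔m z (maxL x zs))

lowest highest : List ℕ → ℕ
lowest  []       = 0
lowest  (x ∷ xs) = minL x xs
highest []       = 0
highest (x ∷ xs) = maxL x xs

lowest-≤ : ∀ {L y} → y ∈ L → lowest L ≤ y
lowest-≤ {x ∷ xs} = minL-≤ x xs

≤-highest : ∀ {L y} → y ∈ L → y ≤ highest L
≤-highest {x ∷ xs} = ≤-maxL x xs

span : List ℕ → ℕ
span L = suc (highest L) ∸ lowest L

span∸length≤defList : ∀ L → 1 ≤ length L → span L ∸ length L ≤ defList L
span∸length≤defList (x ∷ xs) _ = ∸-monoʳ-≤ (span (x ∷ xs)) (List.length-deduplicate _≟_ (x ∷ xs))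

-- Residue classes of an interval

∣[m∸n]-1∣≡m∸1+n : ∀ m n → n < m → ∣ (m ∸ n) - 1 ∣ ≡ m ∸ suc n
∣[m∸n]-1∣≡m∸1+n (suc m) zero    _         = ∣-∣-identityʳ m
∣[m∸n]-1∣≡m∸1+n (suc m) (suc n) (s≤s n<m) = ∣[m∸n]-1∣≡m∸1+n m n n<m

∣[m∸n]-1∣≡1+n∸m : ∀ m n → n ≤ m → m ≤ suc n → ∣ (m ∸ n) - 1 ∣ ≡ suc n ∸ m
∣[m∸n]-1∣≡1+n∸m zero          zero    _         _           = refl
∣[m∸n]-1∣≡1+n∸m (suc zero)    zero    _         _           = refl
∣[m∸n]-1∣≡1+n∸m (suc (suc m)) zero    _         (s≤s ())
∣[m∸n]-1∣≡1+n∸m (suc m)       (suc n) (s≤s n≤m) (s≤s m≤1+n) = ∣[m∸n]-1∣≡1+n∸m m n n≤m m≤1+n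

module ResidueClasses (D : ℕ) where

  below : ℕ → ℕ → ℕ → ℕ
  below Q ρ x = ∑< Q (λ q → χ (q * D + ρ <? x))

  -- For b ≤ Q * D: the number of c ∈ [a, b) with c ≡ ρ (mod D).
  inClass : ℕ → ℕ → ℕ → ℕ → ℕ
  inClass Q ρ a b = below Q ρ b ∸ below Q ρ a

  below-mono : ∀ Q ρ {x y} → x ≤ y → below Q ρ x ≤ below Q ρ y
  below-mono Q ρ x≤y = ∑<-mono Q (λ q → χ-mono (q * D + ρ <? _) (q * D + ρ <? _) (λ lt → <-≤-trans lt x≤y))

  ∑<-below : ∀ Q {x} → x ≤ Q * D → ∑< D (λ ρ → below Q ρ x) ≡ x
  ∑<-below Q {x} x≤QD = trans (sym (∑<-blocks Q D (λ c → χ (c <? x)))) (∑<-χ< (Q * D) x x≤QD)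

  below-suc : ∀ Q ρ {x} → x ≤ Q * D → below (suc Q) ρ x ≡ below Q ρ x
  below-suc Q ρ x≤QD =
    trans (cong (below Q ρ _ +_) (χ-no (Q * D + ρ <? _) (λ lt → <⇒≱ lt (≤-trans x≤QD (m≤m+n (Q * D) ρ)))))
          (+-identityʳ _)

  below-suc-+D : ∀ Q {ρ} x → ρ < D → below (suc Q) ρ (x + D) ≡ suc (below Q ρ x)
  below-suc-+D Q {ρ} x ρ<D = begin
    ∑< (suc Q) (λ q → χ (q * D + ρ <? x + D))                 ≡⟨ ∑<-split 1 Q (λ q → χ (q * D + ρ <? x + D)) ⟩
    0 + χ (ρ <? x + D) + ∑< Q (λ q → χ (D + q * D + ρ <? x + D))
      ≡⟨ cong₂ (λ u w → 0 + u + w) (χ-yes (ρ <? x + D) (<-≤-trans ρ<D (m≤n+m D x)))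
                                   (∑<-cong Q (λ q _ → χ-cong (D + q * D + ρ <? x + D) (q * D + ρ <? x) (shift⁻ q) (shift q))) ⟩
    suc (below Q ρ x)                                          ∎
    where
    open ≡-Reasoning
    D+[qD+ρ] : ∀ q → D + q * D + ρ ≡ D + (q * D + ρ)
    D+[qD+ρ] q = +-assoc D (q * D) ρ
    shift : ∀ q → q * D + ρ < x → D + q * D + ρ < x + D
    shift q lt = subst₂ _<_ (sym (D+[qD+ρ] q)) (+-comm D x) (+-monoʳ-< D lt)
    shift⁻ : ∀ q → D + q * D + ρ < x + D → q * D + ρ < x
    shift⁻ q lt = +-cancelˡ-< D (q * D + ρ) x (subst₂ _<_ (D+[qD+ρ] q) (+-comm x D) lt)

  below-+D : ∀ Q {ρ} x → ρ < D → x + D ≤ Q * D → below Q ρ (x + D) ≡ suc (below Q ρ x)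
  below-+D zero    x ρ<D x+D≤0 = ⊥-elim (<⇒≱ (<-≤-trans ρ<D (m≤n+m D x)) (≤-trans x+D≤0 z≤n))
  below-+D (suc Q) {ρ} x ρ<D x+D≤QD = begin
    below (suc Q) ρ (x + D)   ≡⟨ below-suc-+D Q x ρ<D ⟩
    suc (below Q ρ x)         ≡⟨ cong suc (below-suc Q ρ x≤QD) ⟨
    suc (below (suc Q) ρ x)   ∎
    where
    open ≡-Reasoning
    x≤QD : x ≤ Q * D
    x≤QD = +-cancelʳ-≤ D x (Q * D) (subst (x + D ≤_) (+-comm D (Q * D)) x+D≤QD)

  ∑<-inRange-class : ∀ Q ρ {a b} → a ≤ b → ∑< Q (λ q → inRange a b (q * D + ρ)) ≡ inClass Q ρ a b
  ∑<-inRange-class Q ρ a≤b = ∑<-∸ Q (λ q → χ-mono (q * D + ρ <? _) (q * D + ρ <? _) (λ lt → <-≤-trans lt a≤b))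

  ∑<-∣inClass-1∣ : ∀ Q {a b} → a ≤ b → a + D ≤ Q * D → b ≤ Q * D →
                   ∑< D (λ ρ → ∣ inClass Q ρ a b - 1 ∣) ≡ ∣ (b ∸ a) - D ∣
  ∑<-∣inClass-1∣ Q {a} {b} a≤b a+D≤QD b≤QD with a + D ≤? b
  ... | yes a+D≤b = begin
    ∑< D (λ ρ → ∣ inClass Q ρ a b - 1 ∣)                       ≡⟨ ∑<-cong D deviation ⟩
    ∑< D (λ ρ → below Q ρ b ∸ below Q ρ (a + D))               ≡⟨ ∑<-∸ D (λ ρ → below-mono Q ρ a+D≤b) ⟩
    ∑< D (λ ρ → below Q ρ b) ∸ ∑< D (λ ρ → below Q ρ (a + D))  ≡⟨ cong₂ _∸_ (∑<-below Q b≤QD) (∑<-below Q a+D≤QD) ⟩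
    b ∸ (a + D)                                                ≡⟨ ∸-+-assoc b a D ⟨
    b ∸ a ∸ D                                                  ≡⟨ m≤n⇒∣n-m∣≡n∸m D≤b∸a ⟨
    ∣ (b ∸ a) - D ∣                                            ∎
    where
    open ≡-Reasoning
    D≤b∸a : D ≤ b ∸ a
    D≤b∸a = m+n≤o⇒m≤o∸n D (subst (_≤ b) (+-comm a D) a+D≤b)
    deviation : ∀ ρ → ρ < D → ∣ inClass Q ρ a b - 1 ∣ ≡ below Q ρ b ∸ below Q ρ (a + D)
    deviation ρ ρ<D rewrite below-+D Q a ρ<D a+D≤QD =
      ∣[m∸n]-1∣≡m∸1+n _ _ (subst (_≤ below Q ρ b) (below-+D Q a ρ<D a+D≤QD) (below-mono Q ρ a+D≤b))
  ... | no a+D≰b = begin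
    ∑< D (λ ρ → ∣ inClass Q ρ a b - 1 ∣)                       ≡⟨ ∑<-cong D deviation ⟩
    ∑< D (λ ρ → below Q ρ (a + D) ∸ below Q ρ b)               ≡⟨ ∑<-∸ D (λ ρ → below-mono Q ρ b≤a+D) ⟩
    ∑< D (λ ρ → below Q ρ (a + D)) ∸ ∑< D (λ ρ → below Q ρ b)  ≡⟨ cong₂ _∸_ (∑<-below Q a+D≤QD) (∑<-below Q b≤QD) ⟩
    a + D ∸ b                                                  ≡⟨ cong (a + D ∸_) (m+[n∸m]≡n a≤b) ⟨
    a + D ∸ (a + (b ∸ a))                                      ≡⟨ [m+n]∸[m+o]≡n∸o a D (b ∸ a) ⟩
    D ∸ (b ∸ a)                                                ≡⟨ m≤n⇒∣m-n∣≡n∸m (m≤n+o⇒m∸n≤o b a b≤a+D) ⟨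
    ∣ (b ∸ a) - D ∣                                            ∎
    where
    open ≡-Reasoning
    b≤a+D : b ≤ a + D
    b≤a+D = <⇒≤ (≰⇒> a+D≰b)
    deviation : ∀ ρ → ρ < D → ∣ inClass Q ρ a b - 1 ∣ ≡ below Q ρ (a + D) ∸ below Q ρ b
    deviation ρ ρ<D rewrite below-+D Q a ρ<D a+D≤QD =
      ∣[m∸n]-1∣≡1+n∸m _ _ (below-mono Q ρ a≤b)
        (subst (below Q ρ b ≤_) (below-+D Q a ρ<D a+D≤QD) (below-mono Q ρ b≤a+D))

[1+a]*m+m*[m∸a]≡m+m*m : ∀ {a m} → a ≤ m → suc a * m + m * (m ∸ a) ≡ m + m * m
[1+a]*m+m*[m∸a]≡m+m*m {a} {m} a≤m = subst (λ m → suc a * m + m * (m ∸ a) ≡ m + m * m) (m+[n∸m]≡n a≤m)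
  (trans (cong (λ t → suc a * (a + (m ∸ a)) + (a + (m ∸ a)) * t) (m+n∸m≡n a (m ∸ a))) (identity a (m ∸ a)))
  where
  identity : ∀ a t → suc a * (a + t) + (a + t) * t ≡ a + t + (a + t) * (a + t)
  identity = solve-∀

-- Proper colourings of complete multipartite graphs

module ColoringBound (k : ℕ) (n : Fin (suc (suc k)) → ℕ) (n-pos : ∀ i → 1 ≤ n i)
                     (n₀-min : ∀ i → n zero ≤ n i) (α : ProperEdgeColoring n) where

  V : List (Vertex n)
  V = vertices n

  D : ℕ
  D = ∑ᶠ (suc k) (λ i → n (suc i))

  ∑-vertices : (g : Vertex n → ℕ) → ∑ V g ≡ ∑ᶠ (suc (suc k)) (λ i → ∑ᶠ (n i) (λ j → g (i , j)))
  ∑-vertices g = begin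
    ∑ V g
      ≡⟨ ∑-concatMap row (allFinL (suc (suc k))) g ⟩
    ∑ (allFinL (suc (suc k))) (λ i → ∑ (row i) g)
      ≡⟨ ∑-allFin (suc (suc k)) (λ i → ∑ (row i) g) ⟩
    ∑ᶠ (suc (suc k)) (λ i → ∑ (row i) g)
      ≡⟨ ∑ᶠ-cong (suc (suc k)) (λ i → trans (∑-map (i ,_) (allFinL (n i)) g) (∑-allFin (n i) (λ j → g (i , j)))) ⟩
    ∑ᶠ (suc (suc k)) (λ i → ∑ᶠ (n i) (λ j → g (i , j)))
      ∎
    where
    open ≡-Reasoning
    row : (i : Fin (suc (suc k))) → List (Vertex n)
    row i = map (i ,_) (allFinL (n i))

  ∈-vertices : ∀ v → v ∈ V
  ∈-vertices (i , j) = ∈-concatMap⁺ (λ i → map (i ,_) (allFinL (n i)))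
                         (Any.map (λ { refl → ∈-map⁺ (i ,_) (∈-allFin j) }) (∈-allFin i))

  adj? : (v w : Vertex n) → Dec (Adj n v w)
  adj? v w = ¬? (proj₁ v Fin.≟ proj₁ w)

  colors : Vertex n → List ℕ
  colors = colorsAt α

  degree lo hi : Vertex n → ℕ
  degree v = length (colors v)
  lo v = lowest (colors v)
  hi v = highest (colors v)

  inHull : Vertex n → ℕ → ℕ
  inHull v = inRange (lo v) (suc (hi v))

  degree≡∑adj : ∀ v → degree v ≡ ∑ V (λ w → χ (adj? v w))
  degree≡∑adj v = trans (List.length-map (col α v) (neighbours n v)) (length-filter (adj? v) V)

  degree+part≡n₀+D : ∀ v → degree v + n (proj₁ v) ≡ n zero + D
  degree+part≡n₀+D v = begin
    degree v + n (proj₁ v)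
      ≡⟨ cong (_+ n (proj₁ v)) (trans (degree≡∑adj v) (∑-vertices (λ w → χ (adj? v w)))) ⟩
    ∑ᶠ (suc (suc k)) (λ i → ∑ᶠ (n i) (λ _ → χ (¬? (proj₁ v Fin.≟ i)))) + n (proj₁ v)
      ≡⟨ cong (_+ n (proj₁ v)) (∑ᶠ-cong (suc (suc k)) (λ i → ∑ᶠ-const (n i) (χ (¬? (proj₁ v Fin.≟ i))))) ⟩
    ∑ᶠ (suc (suc k)) (λ i → n i * χ (¬? (proj₁ v Fin.≟ i))) + n (proj₁ v)
      ≡⟨ ∑ᶠ-except (suc (suc k)) n (proj₁ v) ⟩
    n zero + D
      ∎
    where open ≡-Reasoning

  degree≤D : ∀ v → degree v ≤ D
  degree≤D v = +-cancelʳ-≤ (n zero) (degree v) D (begin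
    degree v + n zero        ≤⟨ +-monoʳ-≤ (degree v) (n₀-min (proj₁ v)) ⟩
    degree v + n (proj₁ v)   ≡⟨ degree+part≡n₀+D v ⟩
    n zero + D               ≡⟨ +-comm (n zero) D ⟩
    D + n zero               ∎)
    where open ≤-Reasoning

  D∸degree≡part∸n₀ : ∀ v → D ∸ degree v ≡ n (proj₁ v) ∸ n zero
  D∸degree≡part∸n₀ v = trans (cong (_∸ degree v) D≡) (m+n∸m≡n (degree v) excess)
    where
    excess = n (proj₁ v) ∸ n zero
    D≡ : D ≡ degree v + excess
    D≡ = +-cancelˡ-≡ (n zero) D (degree v + excess) (begin
      n zero + D                   ≡⟨ degree+part≡n₀+D v ⟨
      degree v + n (proj₁ v)       ≡⟨ cong (degree v +_) (m+[n∸m]≡n (n₀-min (proj₁ v))) ⟨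
      degree v + (n zero + excess) ≡⟨ +-CS.x∙yz≈y∙xz (degree v) (n zero) excess ⟩
      n zero + (degree v + excess) ∎)
      where open ≡-Reasoning

  1≤D : 1 ≤ D
  1≤D = ≤-trans (n-pos (suc zero)) (m≤m+n _ _)

  1≤degree : ∀ v → 1 ≤ degree v
  1≤degree (zero , j)  = ≤-trans 1≤D (≤-reflexive (sym degree≡D))
    where
    degree≡D : degree (zero , j) ≡ D
    degree≡D = +-cancelʳ-≡ (n zero) (degree (zero , j)) D (trans (degree+part≡n₀+D (zero , j)) (+-comm (n zero) D))
  1≤degree (suc i , j) = ≤-trans (n-pos zero) (+-cancelʳ-≤ (n (suc i)) (n zero) (degree (suc i , j)) (begin
    n zero + n (suc i)                 ≤⟨ +-monoʳ-≤ (n zero) (∑ᶠ-≥ (suc k) (λ i → n (suc i)) i) ⟩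
    n zero + D                         ≡⟨ degree+part≡n₀+D (suc i , j) ⟨
    degree (suc i , j) + n (suc i)     ∎))
    where open ≤-Reasoning

  col∈colors : ∀ v w → Adj n v w → col α v w ∈ colors v
  col∈colors v w v~w = ∈-map⁺ (col α v) (∈-filter⁺ (adj? v) (∈-vertices w) v~w)

  lo≤col : ∀ v w → Adj n v w → lo v ≤ col α v w
  lo≤col v w v~w = lowest-≤ (col∈colors v w v~w)

  col≤hi : ∀ v w → Adj n v w → col α v w ≤ hi v
  col≤hi v w v~w = ≤-highest (col∈colors v w v~w)

  lo≤hi : ∀ v → lo v ≤ hi v
  lo≤hi v with colors v | 1≤degree v
  ... | x ∷ xs | _ = ≤-trans (minL-≤ x xs (here refl)) (≤-maxL x xs (here refl))

  -- Every colour is below M, and M is a multiple of D: the colours split into Q full residue blocks.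
  Q M : ℕ
  Q = suc (∑ V hi)
  M = Q * D

  hi+D≤M : ∀ v → hi v + D ≤ M
  hi+D≤M v = begin
    hi v + D            ≤⟨ +-monoˡ-≤ D (∑-≥ V hi (∈-vertices v)) ⟩
    ∑ V hi + D          ≤⟨ +-monoˡ-≤ D (subst (_≤ ∑ V hi * D) (*-identityʳ (∑ V hi)) (*-monoʳ-≤ (∑ V hi) 1≤D)) ⟩
    ∑ V hi * D + D      ≡⟨ +-comm (∑ V hi * D) D ⟩
    M                   ∎
    where open ≤-Reasoning

  1+hi≤M : ∀ v → suc (hi v) ≤ M
  1+hi≤M v = ≤-trans (subst (_≤ hi v + D) (+-comm (hi v) 1) (+-monoʳ-≤ (hi v) 1≤D)) (hi+D≤M v)

  lo+D≤M : ∀ v → lo v + D ≤ M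
  lo+D≤M v = ≤-trans (+-monoˡ-≤ D (lo≤hi v)) (hi+D≤M v)

  edgeColored : Vertex n → Vertex n → ℕ → ℕ
  edgeColored v w c = χ (adj? v w) * χ (col α v w ≟ c)

  edgeColored-sym : ∀ c v w → edgeColored v w c ≡ edgeColored w v c
  edgeColored-sym c v w with adj? v w | adj? w v
  ... | yes v~w | yes _   = cong (λ x → 1 * χ (x ≟ c)) (symm α v w v~w)
  ... | yes v~w | no w≁v  = ⊥-elim (w≁v (λ eq → v~w (sym eq)))
  ... | no v≁w  | yes w~v = ⊥-elim (v≁w (λ eq → w~v (sym eq)))
  ... | no _    | no _    = refl

  edgeColored-irrefl : ∀ c v → edgeColored v v c ≡ 0
  edgeColored-irrefl c v = cong (_* χ (col α v v ≟ c)) (χ-no (adj? v v) (λ v≁v → v≁v refl))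

  edgeColored≤1 : ∀ v w c → edgeColored v w c ≤ 1
  edgeColored≤1 v w c = *-mono-≤ (χ≤1 (adj? v w)) (χ≤1 (col α v w ≟ c))

  edgeColored-positive : ∀ v w c → 1 ≤ edgeColored v w c → Adj n v w × col α v w ≡ c
  edgeColored-positive v w c 1≤e with adj? v w | col α v w ≟ c
  ... | yes v~w | yes eq = v~w , eq
  ... | yes _   | no _   = ⊥-elim (1+n≰n (≤-trans 1≤e (≤-reflexive (*-zeroʳ 1))))
  ... | no _    | _      = ⊥-elim (1+n≰n 1≤e)

  edgeColored-unique : ∀ v w w' c → 1 ≤ edgeColored v w c → 1 ≤ edgeColored v w' c → w ≡ w'
  edgeColored-unique v w w' c 1≤e 1≤e' with Product.≡-dec Fin._≟_ Fin._≟_ w w'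
  ... | yes w≡w' = w≡w'
  ... | no w≢w'  with edgeColored-positive v w c 1≤e | edgeColored-positive v w' c 1≤e'
  ...   | v~w , eq | v~w' , eq' = ⊥-elim (proper α v w w' v~w v~w' w≢w' (trans eq (sym eq')))

  colorCount : Vertex n → ℕ → ℕ
  colorCount v c = ∑ V (λ w → edgeColored v w c)

  colorCount≤1 : ∀ v c → colorCount v c ≤ 1
  colorCount≤1 v c = subst (_≤ 1) (sym (∑-vertices (λ w → edgeColored v w c)))
    (∑ᶠ-≤1 (suc (suc k)) (λ i → ∑ᶠ (n i) (λ j → edgeColored v (i , j) c))
      (λ i → ∑ᶠ-≤1 (n i) (λ j → edgeColored v (i , j) c) (λ j → edgeColored≤1 v (i , j) c)
               (λ j j' p p' → ,-injectiveʳ (edgeColored-unique v (i , j) (i , j') c p p')))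
      samePart)
    where
    ,-injectiveʳ : ∀ {i} {j j' : Fin (n i)} → _≡_ {A = Vertex n} (i , j) (i , j') → j ≡ j'
    ,-injectiveʳ refl = refl
    samePart : ∀ i i' → 1 ≤ ∑ᶠ (n i) (λ j → edgeColored v (i , j) c) → 1 ≤ ∑ᶠ (n i') (λ j → edgeColored v (i' , j) c) → i ≡ i'
    samePart i i' p p' with ∑ᶠ-positive (n i) _ p | ∑ᶠ-positive (n i') _ p'
    ... | j , q | j' , q' = cong proj₁ (edgeColored-unique v (i , j) (i' , j') c q q')

  colorCount-absent : ∀ v c → (∀ w → Adj n v w → col α v w ≢ c) → colorCount v c ≤ 0
  colorCount-absent v c absent = subst (colorCount v c ≤_) (∑-zero V) (∑-mono V none)
    where
    none : ∀ w → edgeColored v w c ≤ 0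
    none w with edgeColored v w c in eq
    ... | zero  = z≤n
    ... | suc _ with edgeColored-positive v w c (subst (1 ≤_) (sym eq) (s≤s z≤n))
    ...   | v~w , col≡c = ⊥-elim (absent w v~w col≡c)

  colorCount≤inHull : ∀ v c → colorCount v c ≤ inHull v c
  colorCount≤inHull v c = bound (c <? suc (hi v)) (c <? lo v)
    where
    bound : (c≤hi? : Dec (c < suc (hi v))) (c<lo? : Dec (c < lo v)) → colorCount v c ≤ χ c≤hi? ∸ χ c<lo?
    bound (yes _)   (no _)    = colorCount≤1 v c
    bound (yes _)   (yes c<lo) =
      colorCount-absent v c (λ w v~w col≡c → <⇒≱ c<lo (subst (lo v ≤_) col≡c (lo≤col v w v~w)))
    bound (no c≰hi) c<lo?     = subst (colorCount v c ≤_) (sym (0∸n≡0 (χ c<lo?)))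
      (colorCount-absent v c (λ w v~w col≡c → c≰hi (s≤s (subst (_≤ hi v) col≡c (col≤hi v w v~w)))))

  ∑<-edgeColored : ∀ v w → ∑< M (edgeColored v w) ≡ χ (adj? v w)
  ∑<-edgeColored v w = trans (∑<-*ˡ M (χ (adj? v w)) (λ c → χ (col α v w ≟ c))) (onEdge (adj? v w))
    where
    onEdge : (v~w? : Dec (Adj n v w)) → χ v~w? * ∑< M (λ c → χ (col α v w ≟ c)) ≡ χ v~w?
    onEdge (no _)    = refl
    onEdge (yes v~w) = begin
      1 * ∑< M (λ c → χ (col α v w ≟ c))        ≡⟨ *-identityˡ _ ⟩
      ∑< M (λ c → χ (col α v w ≟ c))            ≡⟨ ∑<-cong M (λ c _ → χ≟-inRange (col α v w) c) ⟩
      ∑< M (inRange (col α v w) (suc (col α v w)))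
        ≡⟨ ∑<-inRange M (n≤1+n _) (≤-trans (s≤s (col≤hi v w v~w)) (1+hi≤M v)) ⟩
      suc (col α v w) ∸ col α v w               ≡⟨ m+n∸n≡m 1 (col α v w) ⟩
      1                                         ∎
      where open ≡-Reasoning

  ∑<-colorCount : ∀ v → ∑< M (colorCount v) ≡ degree v
  ∑<-colorCount v = begin
    ∑< M (colorCount v)                        ≡⟨ ∑<-∑ M V (λ w c → edgeColored v w c) ⟩
    ∑ V (λ w → ∑< M (edgeColored v w))         ≡⟨ ∑-cong V (∑<-edgeColored v) ⟩
    ∑ V (λ w → χ (adj? v w))                   ≡⟨ degree≡∑adj v ⟨
    degree v                                   ∎
    where open ≡-Reasoning

  ∑<-inHull : ∀ v → ∑< M (inHull v) ≡ span (colors v)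
  ∑<-inHull v = ∑<-inRange M (≤-trans (lo≤hi v) (n≤1+n _)) (1+hi≤M v)

  gap : Vertex n → ℕ
  gap v = span (colors v) ∸ degree v

  ∑<-uncolored : ∀ v → ∑< M (λ c → inHull v c ∸ colorCount v c) ≡ gap v
  ∑<-uncolored v = trans (∑<-∸ M (colorCount≤inHull v)) (cong₂ _∸_ (∑<-inHull v) (∑<-colorCount v))

  degree≤span : ∀ v → degree v ≤ span (colors v)
  degree≤span v = subst₂ _≤_ (∑<-colorCount v) (∑<-inHull v) (∑<-mono M (colorCount≤inHull v))

  ∑-gap≤def : ∑ V gap ≤ defColoring α
  ∑-gap≤def = ∑-mono V (λ v → span∸length≤defList (colors v) (1≤degree v))

  coverage : ℕ → ℕ
  coverage c = ∑ V (λ v → inHull v c)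

  coverage%2≤uncolored : ∀ c → coverage c % 2 ≤ ∑ V (λ v → inHull v c ∸ colorCount v c)
  coverage%2≤uncolored c with ∑∑-symmetric-double V (λ v w → edgeColored v w c) (edgeColored-sym c) (edgeColored-irrefl c)
  ... | m , ∑colorCount≡m+m = begin
    coverage c % 2                                ≤⟨ %2≤∸-double (coverage c) m 2m≤coverage ⟩
    coverage c ∸ (m + m)                          ≡⟨ cong (coverage c ∸_) ∑colorCount≡m+m ⟨
    coverage c ∸ ∑ V (λ v → colorCount v c)       ≡⟨ ∑-∸ V (λ v → colorCount≤inHull v c) ⟨
    ∑ V (λ v → inHull v c ∸ colorCount v c)       ∎
    where
    open ≤-Reasoning
    2m≤coverage : m + m ≤ coverage c
    2m≤coverage = subst (_≤ coverage c) ∑colorCount≡m+m (∑-mono V (λ v → colorCount≤inHull v c))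

  oddCoverage : ℕ
  oddCoverage = ∑< M (λ c → coverage c % 2)

  oddCoverage≤∑gap : oddCoverage ≤ ∑ V gap
  oddCoverage≤∑gap = begin
    ∑< M (λ c → coverage c % 2)                                ≤⟨ ∑<-mono M coverage%2≤uncolored ⟩
    ∑< M (λ c → ∑ V (λ v → inHull v c ∸ colorCount v c))       ≡⟨ ∑<-∑ M V (λ v c → inHull v c ∸ colorCount v c) ⟩
    ∑ V (λ v → ∑< M (λ c → inHull v c ∸ colorCount v c))       ≡⟨ ∑-cong V ∑<-uncolored ⟩
    ∑ V gap                                                    ∎
    where open ≤-Reasoning

  ∑-vertices-one : ∑ V (λ _ → 1) ≡ total n
  ∑-vertices-one = begin
    ∑ V (λ _ → 1)                                      ≡⟨ ∑-vertices (λ _ → 1) ⟩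
    ∑ᶠ (suc (suc k)) (λ i → ∑ᶠ (n i) (λ _ → 1))        ≡⟨ ∑ᶠ-cong (suc (suc k)) (λ i → trans (∑ᶠ-const (n i) 1) (*-identityʳ (n i))) ⟩
    ∑ᶠ (suc (suc k)) n                                 ≡⟨ ∑-allFin (suc (suc k)) n ⟨
    total n                                            ∎
    where open ≡-Reasoning

  open ResidueClasses D

  classCount : Vertex n → ℕ → ℕ
  classCount v ρ = inClass Q ρ (lo v) (suc (hi v))

  ∑-classCount%2≤oddCoverage : ∑< D (λ ρ → ∑ V (λ v → classCount v ρ) % 2) ≤ oddCoverage
  ∑-classCount%2≤oddCoverage = begin
    ∑< D (λ ρ → ∑ V (λ v → classCount v ρ) % 2)         ≡⟨ ∑<-cong D (λ ρ _ → cong (_% 2) (sym (coverage-in-class ρ))) ⟩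
    ∑< D (λ ρ → ∑< Q (λ q → coverage (q * D + ρ)) % 2)  ≤⟨ ∑<-mono D (λ ρ → ∑<-%2 Q (λ q → coverage (q * D + ρ))) ⟩
    ∑< D (λ ρ → ∑< Q (λ q → coverage (q * D + ρ) % 2))  ≡⟨ ∑<-blocks Q D (λ c → coverage c % 2) ⟨
    oddCoverage                                         ∎
    where
    open ≤-Reasoning
    coverage-in-class : ∀ ρ → ∑< Q (λ q → coverage (q * D + ρ)) ≡ ∑ V (λ v → classCount v ρ)
    coverage-in-class ρ = trans (∑<-∑ Q V (λ v q → inHull v (q * D + ρ)))
                                (∑-cong V (λ v → ∑<-inRange-class Q ρ (≤-trans (lo≤hi v) (n≤1+n _))))

  ∑<-∣classCount-1∣ : ∀ v → ∑< D (λ ρ → ∣ classCount v ρ - 1 ∣) ≤ gap v + (D ∸ degree v)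
  ∑<-∣classCount-1∣ v = begin
    ∑< D (λ ρ → ∣ classCount v ρ - 1 ∣)                     ≡⟨ ∑<-∣inClass-1∣ Q (≤-trans (lo≤hi v) (n≤1+n _)) (lo+D≤M v) (1+hi≤M v) ⟩
    ∣ span (colors v) - D ∣                                 ≤⟨ ∣-∣-triangle (span (colors v)) (degree v) D ⟩
    ∣ span (colors v) - degree v ∣ + ∣ degree v - D ∣       ≡⟨ cong₂ _+_ (m≤n⇒∣n-m∣≡n∸m (degree≤span v)) (m≤n⇒∣m-n∣≡n∸m (degree≤D v)) ⟩
    gap v + (D ∸ degree v)                                  ∎
    where open ≤-Reasoning

  D≤oddCoverage+∑gap+∑deficit : total n % 2 ≡ 1 → D ≤ oddCoverage + (∑ V gap + ∑ V (λ v → D ∸ degree v))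
  D≤oddCoverage+∑gap+∑deficit odd = begin
    D
      ≡⟨ ∑<-one D ⟨
    ∑< D (λ _ → 1)
      ≤⟨ ∑<-mono D (λ ρ → ∑1-odd⇒1≤∑f%2+∑∣f-1∣ V (λ v → classCount v ρ) (trans (cong (_% 2) ∑-vertices-one) odd)) ⟩
    ∑< D (λ ρ → ∑ V (λ v → classCount v ρ) % 2 + ∑ V (λ v → ∣ classCount v ρ - 1 ∣))
      ≡⟨ ∑<-+ D _ _ ⟩
    ∑< D (λ ρ → ∑ V (λ v → classCount v ρ) % 2) + ∑< D (λ ρ → ∑ V (λ v → ∣ classCount v ρ - 1 ∣))
      ≤⟨ +-monoˡ-≤ _ ∑-classCount%2≤oddCoverage ⟩
    oddCoverage + ∑< D (λ ρ → ∑ V (λ v → ∣ classCount v ρ - 1 ∣))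
      ≡⟨ cong (oddCoverage +_) (∑<-∑ D V (λ v ρ → ∣ classCount v ρ - 1 ∣)) ⟩
    oddCoverage + ∑ V (λ v → ∑< D (λ ρ → ∣ classCount v ρ - 1 ∣))
      ≤⟨ +-monoʳ-≤ oddCoverage (∑-mono V ∑<-∣classCount-1∣) ⟩
    oddCoverage + ∑ V (λ v → gap v + (D ∸ degree v))
      ≡⟨ cong (oddCoverage +_) (∑-+ V gap (λ v → D ∸ degree v)) ⟩
    oddCoverage + (∑ V gap + ∑ V (λ v → D ∸ degree v))
      ∎
    where open ≤-Reasoning

  D≤2def+∑deficit : total n % 2 ≡ 1 → D ≤ 2 * defColoring α + ∑ V (λ v → D ∸ degree v)
  D≤2def+∑deficit odd = begin
    D                                  ≤⟨ D≤oddCoverage+∑gap+∑deficit odd ⟩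
    oddCoverage + (∑ V gap + deficit)  ≤⟨ +-mono-≤ (≤-trans oddCoverage≤∑gap ∑-gap≤def) (+-monoˡ-≤ deficit ∑-gap≤def) ⟩
    def + (def + deficit)              ≡⟨ +-assoc def def deficit ⟨
    def + def + deficit                ≡⟨ cong (λ x → def + x + deficit) (+-identityʳ def) ⟨
    2 * def + deficit                  ∎
    where
    open ≤-Reasoning
    def = defColoring α
    deficit = ∑ V (λ v → D ∸ degree v)

  ∑-deficit : ∑ V (λ v → D ∸ degree v) ≡ ∑ᶠ (suc k) (λ i → n (suc i) * (n (suc i) ∸ n zero))
  ∑-deficit = begin
    ∑ V (λ v → D ∸ degree v)
      ≡⟨ ∑-cong V D∸degree≡part∸n₀ ⟩
    ∑ V (λ v → n (proj₁ v) ∸ n zero)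
      ≡⟨ ∑-vertices (λ v → n (proj₁ v) ∸ n zero) ⟩
    ∑ᶠ (suc (suc k)) (λ i → ∑ᶠ (n i) (λ _ → n i ∸ n zero))
      ≡⟨ ∑ᶠ-cong (suc (suc k)) (λ i → ∑ᶠ-const (n i) (n i ∸ n zero)) ⟩
    n zero * (n zero ∸ n zero) + rest
      ≡⟨ cong (λ x → n zero * x + rest) (n∸n≡0 (n zero)) ⟩
    n zero * 0 + rest
      ≡⟨ cong (_+ rest) (*-zeroʳ (n zero)) ⟩
    rest
      ∎
    where
    open ≡-Reasoning
    rest = ∑ᶠ (suc k) (λ i → n (suc i) * (n (suc i) ∸ n zero))

  ∑-linear≤2def+∑-square : total n % 2 ≡ 1 →
    ∑ (allFinL (suc k)) (λ i → suc (n zero) * n (suc i)) ≤ 2 * defColoring α + ∑ (allFinL (suc k)) (λ i → n (suc i) * n (suc i))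
  ∑-linear≤2def+∑-square odd = +-cancelʳ-≤ (∑ Is excess) _ _ (begin
    ∑ Is linear + ∑ Is excess                   ≡⟨ ∑-+ Is linear excess ⟨
    ∑ Is (λ i → linear i + excess i)            ≡⟨ ∑-cong Is (λ i → [1+a]*m+m*[m∸a]≡m+m*m (n₀-min (suc i))) ⟩
    ∑ Is (λ i → n (suc i) + square i)           ≡⟨ ∑-+ Is (λ i → n (suc i)) square ⟩
    ∑ Is (λ i → n (suc i)) + ∑ Is square        ≡⟨ cong (_+ ∑ Is square) (∑-allFin (suc k) (λ i → n (suc i))) ⟩
    D + ∑ Is square                             ≤⟨ +-monoˡ-≤ (∑ Is square) (D≤2def+∑deficit odd) ⟩
    2 * def + deficit + ∑ Is square             ≡⟨ cong (λ x → 2 * def + x + ∑ Is square) (trans ∑-deficit (sym (∑-allFin (suc k) excess))) ⟩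
    2 * def + ∑ Is excess + ∑ Is square         ≡⟨ +-CS.xy∙z≈xz∙y (2 * def) (∑ Is excess) (∑ Is square) ⟩
    2 * def + ∑ Is square + ∑ Is excess         ∎)
    where
    open ≤-Reasoning
    Is = allFinL (suc k)
    def = defColoring α
    deficit = ∑ V (λ v → D ∸ degree v)
    linear square excess : Fin (suc k) → ℕ
    linear i = suc (n zero) * n (suc i)
    square i = n (suc i) * n (suc i)
    excess i = n (suc i) * (n (suc i) ∸ n zero)

-- Imported only now: the prefix +_ of Data.Integer makes sections such as (x +_) on ℕ ambiguous.
open import Data.Integer as ℤ using (+_; _⊖_)
import Data.Integer.Properties as ℤ
import Data.Integer.Tactic.RingSolver as ℤ-Solver

foldr-+-difference : (xs : List A) (a b : A → ℕ) →
  foldr ℤ._+_ (+ 0) (map (λ x → + a x ℤ.- + b x) xs) ≡ + ∑ xs a ℤ.- + ∑ xs b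
foldr-+-difference []       a b = refl
foldr-+-difference (x ∷ xs) a b = begin
  (+ a x ℤ.- + b x) ℤ.+ foldr ℤ._+_ (+ 0) (map (λ x → + a x ℤ.- + b x) xs)
    ≡⟨ cong (ℤ._+_ (+ a x ℤ.- + b x)) (foldr-+-difference xs a b) ⟩
  (+ a x ℤ.- + b x) ℤ.+ (+ ∑ xs a ℤ.- + ∑ xs b)
    ≡⟨ regroup (+ a x) (+ b x) (+ ∑ xs a) (+ ∑ xs b) ⟩
  (+ a x ℤ.+ + ∑ xs a) ℤ.- (+ b x ℤ.+ + ∑ xs b)
    ≡⟨ cong₂ ℤ._-_ (ℤ.pos-+ (a x) (∑ xs a)) (ℤ.pos-+ (b x) (∑ xs b)) ⟨
  + ∑ (x ∷ xs) a ℤ.- + ∑ (x ∷ xs) b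
    ∎
  where
  open ≡-Reasoning
  regroup : ∀ p q r s → (p ℤ.- q) ℤ.+ (r ℤ.- s) ≡ (p ℤ.+ r) ℤ.- (q ℤ.+ s)
  regroup = ℤ-Solver.solve-∀

[+m]-[+n]≤+o : ∀ {m n o} → m ≤ o + n → + m ℤ.- + n ℤ.≤ + o
[+m]-[+n]≤+o {m} {n} {o} m≤o+n = begin
  + m ℤ.- + n    ≡⟨ ℤ.[+m]-[+n]≡m⊖n m n ⟩
  m ⊖ n          ≤⟨ ℤ.⊖-monoˡ-≤ n m≤o+n ⟩
  (o + n) ⊖ n    ≡⟨ ℤ.≤-⊖ (m≤n+m n o) ⟩
  + (o + n ∸ n)  ≡⟨ cong +_ (m+n∸n≡m o n) ⟩
  + o            ∎
  where open ℤ.≤-Reasoning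

lemma4 : (k : ℕ) → 2 ≤ k → (n : Fin (suc k) → ℕ)
    → (∀ i → 1 ≤ n i)
    → (∀ i j → i Fin.≤ j → n i ≤ n j)
    → total n % 2 ≡ 1
    → (α : ProperEdgeColoring n)
    → sumℤ (λ (i : Fin k) → (+ (suc (n zero) ℕ.* n (suc i))) ℤ.- (+ (n (suc i) ℕ.* n (suc i))))
        ℤ.≤ + 2 ℤ.* + defColoring α
lemma4 (suc (suc k)) (s≤s (s≤s z≤n)) n n-pos n-mono odd α = begin
  sumℤ (λ i → + linear i ℤ.- + square i)          ≡⟨ foldr-+-difference (allFinL (suc (suc k))) linear square ⟩
  + ∑ (allFinL (suc (suc k))) linear ℤ.- + ∑ (allFinL (suc (suc k))) square
                                                  ≤⟨ [+m]-[+n]≤+o (∑-linear≤2def+∑-square odd) ⟩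
  + (2 * defColoring α)                           ≡⟨ ℤ.pos-* 2 (defColoring α) ⟩
  + 2 ℤ.* + defColoring α                         ∎
  where
  open ℤ.≤-Reasoning
  open ColoringBound (suc k) n n-pos (λ i → n-mono zero i z≤n) α
  linear square : Fin (suc (suc k)) → ℕ
  linear i = suc (n zero) * n (suc i)
  square i = n (suc i) * n (suc i)
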